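{- Every computable graph $G$ has a computable copy (a computable graph isomorphic to $G$) in which the set of isolated vertices is computable.
   Context: A graph is a set of vertices $V\subseteq\mathbb{N}$ with an irreflexive symmetric edge relation; it is computable if $V$ and the edge relation are computable. A vertex is isolated if it has no neighbors. -}

module Defs where

open import Data.Nat using (ℕ; zero; suc; _<_)
open import Data.Fin using (Fin)
open import Data.Bool using (Bool; true; false)
open import Data.Vec using (Vec; []; _∷_; lookup)
open import Data.Product using (Σ; _×_; ∃)
open import Relation.Nullary using (¬_)
open import Relation.Binary.PropositionalEquality using (_≡_)

-- Model of computation: Kleene's partial (μ-)recursive functions.

data PR : ℕ → Set where
  Z    : ∀ {n} → PR n
  S    : PR 1
  P    : ∀ {n} → Fin n → PR n
  C    : ∀ {m n} → PR m → Vec (PR n) m → PR n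
  R    : ∀ {n} → PR n → PR (suc (suc n)) → PR (suc n)
  M    : ∀ {n} → PR (suc n) → PR n

data _[_]⇓_ : ∀ {n} → PR n → Vec ℕ n → ℕ → Set
data _[_]⇓*_ : ∀ {n m} → Vec (PR n) m → Vec ℕ n → Vec ℕ m → Set

data _[_]⇓_ where
  ev-Z : ∀ {n} {xs : Vec ℕ n} → Z [ xs ]⇓ 0
  ev-S : ∀ {x} → S [ x ∷ [] ]⇓ suc x
  ev-P : ∀ {n} {i : Fin n} {xs} → P i [ xs ]⇓ lookup xs i
  ev-C : ∀ {m n} {f : PR m} {gs : Vec (PR n) m} {xs ys z} →
         gs [ xs ]⇓* ys → f [ ys ]⇓ z → C f gs [ xs ]⇓ z
  ev-R0 : ∀ {n} {g : PR n} {h xs z} →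
          g [ xs ]⇓ z → R g h [ 0 ∷ xs ]⇓ z
  ev-RS : ∀ {n} {g : PR n} {h xs y z w} →
          R g h [ y ∷ xs ]⇓ z → h [ y ∷ z ∷ xs ]⇓ w → R g h [ suc y ∷ xs ]⇓ w
  ev-M : ∀ {n} {f : PR (suc n)} {xs y} →
         f [ y ∷ xs ]⇓ 0 →
         (∀ z → z < y → Σ ℕ (λ k → f [ z ∷ xs ]⇓ suc k)) →
         M f [ xs ]⇓ y

data _[_]⇓*_ where
  []  : ∀ {n} {xs : Vec ℕ n} → [] [ xs ]⇓* []
  _∷_ : ∀ {n m} {g : PR n} {gs : Vec (PR n) m} {xs y ys} →
        g [ xs ]⇓ y → gs [ xs ]⇓* ys → (g ∷ gs) [ xs ]⇓* (y ∷ ys)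

ComputableSet : (ℕ → Set) → Set
ComputableSet A = Σ (PR 1) λ e → ∀ x →
  (A x → e [ x ∷ [] ]⇓ 1) × (¬ A x → e [ x ∷ [] ]⇓ 0)

ComputableRel : (ℕ → ℕ → Set) → Set
ComputableRel A = Σ (PR 2) λ e → ∀ x y →
  (A x y → e [ x ∷ y ∷ [] ]⇓ 1) × (¬ A x y → e [ x ∷ y ∷ [] ]⇓ 0)

record Graph : Set where
  field
    V      : ℕ → Bool
    E      : ℕ → ℕ → Bool
    E-V    : ∀ x y → E x y ≡ true → V x ≡ true
    irrefl : ∀ x → E x x ≡ false
    sym    : ∀ x y → E x y ≡ E y x
open Graph public

_∈V_ : ℕ → Graph → Set
x ∈V G = V G x ≡ true

Adj : Graph → ℕ → ℕ → Set
Adj G x y = E G x y ≡ true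

ComputableGraph : Graph → Set
ComputableGraph G = ComputableSet (λ x → x ∈V G) × ComputableRel (Adj G)

Isolated : Graph → ℕ → Set
Isolated G x = x ∈V G × (∀ y → ¬ Adj G x y)

-- Graph isomorphism: a bijection between vertex sets preserving and
-- reflecting adjacency (maps given as functions on ℕ; only their values on
-- vertices matter).  No computability is required of the isomorphism.
record _≅_ (G H : Graph) : Set where
  field
    to     : ℕ → ℕ
    from   : ℕ → ℕ
    to-V   : ∀ x → x ∈V G → to x ∈V H
    from-V : ∀ y → y ∈V H → from y ∈V G
    from-to : ∀ x → x ∈V G → from (to x) ≡ x
    to-from : ∀ y → y ∈V H → to (from y) ≡ y
    adj    : ∀ x y → x ∈V G → y ∈V G → E G x y ≡ E H (to x) (to y)

{-# OPTIONS --safe #-}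
-- If G has only finitely many isolated vertices, G itself works: a finite set is computable.
-- Otherwise let H have a vertex ⟨⟨x , y⟩ , 0⟩ for every non-isolated vertex x of G, where y is
-- the least neighbour of x, with the edges of G, and isolated vertices ⟨k , 1⟩ for all k.
-- Recording the least neighbour is what makes H computable: ⟨⟨x , y⟩ , 0⟩ is a vertex iff
-- x ~ y and no z < y is adjacent to x, and all quantifiers in the definition of H are bounded
-- by the code itself.  The isolated vertices of H are exactly the ⟨k , 1⟩, and since G has
-- infinitely many isolated vertices, sending the k-th of them to ⟨k , 1⟩ (and x to its code
-- otherwise) is an isomorphism, albeit a non-computable one.
module Submission where

open import Axiom.ExcludedMiddle using (ExcludedMiddle)
open import Data.Bool using (Bool; true; false; _∧_; _∨_; not)
open import Data.Bool.Properties using (not-involutive)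
open import Data.Fin using (Fin; zero; suc)
open import Data.List using (List; []; _∷_; filter; upTo)
open import Data.List.Membership.Propositional.Properties using (∈-filter⁺; ∈-filter⁻; ∈-upTo⁺)
open import Data.Nat using (ℕ; zero; suc; _+_; _*_; _∸_; pred; _≡ᵇ_; _<_; _≤_; _≤′_; ≤′-refl; ≤′-step;
  z≤n; s≤s; s≤s⁻¹)
open import Data.Nat.InfinitelyOften using (Inf) renaming (Fin to Finite)
open import Data.Nat.Properties using (_≟_; anyUpTo?; ≤-refl; ≤-trans; ≤-reflexive; <-irrefl; <-cmp;
  ≰⇒>; ≤⇒≤′; m≤n⇒m<n∨m≡n; m≤m+n; m≤n+m; +-comm; +-monoʳ-≤; +-cancelˡ-≡; *-identityˡ; *-suc;
  *-mono-≤; 0∸n≡0; pred[m∸n]≡m∸[1+n]; module ≤-Reasoning)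
open import Data.List.Membership.DecPropositional _≟_ using (_∈?_)
open import Data.Product using (Σ; ∃; _×_; _,_; proj₁; proj₂)
open import Data.Sum using (_⊎_; inj₁; inj₂; [_,_])
open import Data.Vec using (Vec; []; _∷_; lookup; tabulate; head; tail)
open import Data.Vec.Properties using (tabulate∘lookup)
open import Function using (_∘_)
open import Function.Bundles using (mk⇔)
open import Level using (0ℓ)
open import Relation.Binary using (tri<; tri≈; tri>)
open import Relation.Binary.PropositionalEquality
  using (_≡_; _≢_; refl; sym; trans; cong; subst; _≗_; module ≡-Reasoning)
open import Relation.Nullary
  using (¬_; Dec; does; yes; no; _because_; _×-dec_; _⊎-dec_; ¬?; contradiction)
open import Relation.Nullary.Decidable using (dec-true; dec-false; does-⇔; map′)
open import Relation.Nullary.Reflects using (Reflects; ofʸ; ofⁿ)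
open import Relation.Unary using (Decidable)

open import Defs hiding (sym)

private
  variable
    m n : ℕ
    a b : Vec ℕ n → ℕ
    p q : Vec ℕ n → Bool

-- Functions computed by recursive terms

toℕ : Bool → ℕ
toℕ false = 0
toℕ true = 1

Computable : (Vec ℕ n → ℕ) → Set
Computable {n} f = Σ (PR n) λ e → ∀ xs → e [ xs ]⇓ f xs

Computable* : (Vec ℕ n → Vec ℕ m) → Set
Computable* {n} {m} fs = Σ (Vec (PR n) m) λ es → ∀ xs → es [ xs ]⇓* fs xs

ComputableBool : (Vec ℕ n → Bool) → Set
ComputableBool p = Computable (λ xs → toℕ (p xs))

computable-cong : a ≗ b → Computable a → Computable b
computable-cong a≗b (e , e⇓) = e , λ xs → subst (e [ xs ]⇓_) (a≗b xs) (e⇓ xs)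

[]ᶜ : Computable* {n} (λ _ → [])
[]ᶜ = [] , λ _ → []

infixr 5 _∷ᶜ_
_∷ᶜ_ : {f : Vec ℕ n → ℕ} {fs : Vec ℕ n → Vec ℕ m} →
       Computable f → Computable* fs → Computable* (λ xs → f xs ∷ fs xs)
(e , e⇓) ∷ᶜ (es , es⇓) = e ∷ es , λ xs → e⇓ xs ∷ es⇓ xs

infixr 4 _∘ᶜ_
_∘ᶜ_ : {f : Vec ℕ m → ℕ} {gs : Vec ℕ n → Vec ℕ m} →
       Computable f → Computable* gs → Computable (λ xs → f (gs xs))
(e , e⇓) ∘ᶜ (es , es⇓) = C e es , λ xs → ev-C (es⇓ xs) (e⇓ _)

lookupᶜ : (i : Fin n) → Computable (λ xs → lookup xs i)
lookupᶜ i = P i , λ _ → ev-P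

selectᶜ : (ρ : Fin m → Fin n) → Computable* (λ xs → tabulate (lookup xs ∘ ρ))
selectᶜ {zero} ρ = []ᶜ
selectᶜ {suc m} ρ = lookupᶜ (ρ zero) ∷ᶜ selectᶜ (ρ ∘ suc)

headᶜ : Computable {suc n} head
headᶜ = computable-cong (λ { (x ∷ xs) → refl }) (lookupᶜ zero)

weakenᶜ : Computable a → Computable (λ xs → a (tail xs))
weakenᶜ {a = a} ca =
  computable-cong (λ { (x ∷ xs) → cong a (tabulate∘lookup xs) }) (ca ∘ᶜ selectᶜ suc)

sucᶜ : Computable a → Computable (λ xs → suc (a xs))
sucᶜ ca = S-computes-suc ∘ᶜ ca ∷ᶜ []ᶜ
  where
  S-computes-suc : Computable (λ xs → suc (head xs))
  S-computes-suc = S , λ { (x ∷ []) → ev-S }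

constᶜ : ∀ c → Computable {n} (λ _ → c)
constᶜ zero = Z , λ _ → ev-Z
constᶜ (suc c) = sucᶜ (constᶜ c)

primrec : (Vec ℕ n → ℕ) → (ℕ → ℕ → Vec ℕ n → ℕ) → ℕ → Vec ℕ n → ℕ
primrec g h zero xs = g xs
primrec g h (suc y) xs = h y (primrec g h y xs) xs

primrecᶜ : {g : Vec ℕ n → ℕ} {h : ℕ → ℕ → Vec ℕ n → ℕ} →
  Computable g → Computable (λ zs → h (head zs) (head (tail zs)) (tail (tail zs))) →
  Computable b → Computable (λ xs → primrec g h (b xs) xs)
primrecᶜ {b = b} {g = g} {h} (eg , eg⇓) (eh , eh⇓) cb =
  computable-cong (λ xs → cong (primrec g h (b xs)) (tabulate∘lookup xs))
    (R-computes ∘ᶜ cb ∷ᶜ selectᶜ (λ i → i))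
  where
  R⇓ : ∀ y xs → R eg eh [ y ∷ xs ]⇓ primrec g h y xs
  R⇓ zero xs = ev-R0 (eg⇓ xs)
  R⇓ (suc y) xs = ev-RS (R⇓ y xs) (eh⇓ (y ∷ _ ∷ xs))
  R-computes : Computable (λ ys → primrec g h (head ys) (tail ys))
  R-computes = R eg eh , λ { (y ∷ xs) → R⇓ y xs }

infixl 6 _+ᶜ_ _∸ᶜ_
infixl 7 _*ᶜ_

_+ᶜ_ : Computable a → Computable b → Computable (λ xs → a xs + b xs)
_+ᶜ_ {a = a} {b = b} ca cb =
  computable-cong (λ xs → rec-+ (a xs) xs) (primrecᶜ cb (sucᶜ (weakenᶜ headᶜ)) ca)
  where
  rec-+ : ∀ y xs → primrec b (λ _ acc _ → suc acc) y xs ≡ y + b xs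
  rec-+ zero xs = refl
  rec-+ (suc y) xs = cong suc (rec-+ y xs)

_*ᶜ_ : Computable a → Computable b → Computable (λ xs → a xs * b xs)
_*ᶜ_ {a = a} {b = b} ca cb = computable-cong (λ xs → rec-* (a xs) xs)
  (primrecᶜ (constᶜ 0) (weakenᶜ (weakenᶜ cb) +ᶜ weakenᶜ headᶜ) ca)
  where
  rec-* : ∀ y xs → primrec (λ _ → 0) (λ _ acc xs → b xs + acc) y xs ≡ y * b xs
  rec-* zero xs = refl
  rec-* (suc y) xs = cong (b xs +_) (rec-* y xs)

predᶜ : Computable a → Computable (λ xs → pred (a xs))
predᶜ {a = a} ca = computable-cong (λ xs → rec-pred (a xs))
  (primrecᶜ {h = λ y _ _ → y} (constᶜ 0) headᶜ ca)
  where
  rec-pred : ∀ y {xs} → primrec (λ _ → 0) (λ y _ _ → y) y xs ≡ pred y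
  rec-pred zero = refl
  rec-pred (suc y) = refl

_∸ᶜ_ : Computable a → Computable b → Computable (λ xs → a xs ∸ b xs)
_∸ᶜ_ {a = a} {b = b} ca cb = computable-cong (λ xs → rec-∸ (b xs) xs)
  (primrecᶜ ca (predᶜ (weakenᶜ headᶜ)) cb)
  where
  rec-∸ : ∀ y xs → primrec a (λ _ acc _ → pred acc) y xs ≡ a xs ∸ y
  rec-∸ zero xs = refl
  rec-∸ (suc y) xs = trans (cong pred (rec-∸ y xs)) (pred[m∸n]≡m∸[1+n] (a xs) y)

infixr 3 _∧ᶜ_
infixr 2 _∨ᶜ_
infix 4 _≟ᶜ_

_∧ᶜ_ : ComputableBool p → ComputableBool q → ComputableBool (λ xs → p xs ∧ q xs)
_∧ᶜ_ {p = p} {q = q} cp cq = computable-cong (λ xs → toℕ-∧ (p xs) (q xs)) (cp *ᶜ cq)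
  where
  toℕ-∧ : ∀ x y → toℕ x * toℕ y ≡ toℕ (x ∧ y)
  toℕ-∧ false y = refl
  toℕ-∧ true y = *-identityˡ (toℕ y)

notᶜ : ComputableBool p → ComputableBool (λ xs → not (p xs))
notᶜ {p = p} cp = computable-cong (λ xs → toℕ-not (p xs)) (constᶜ 1 ∸ᶜ cp)
  where
  toℕ-not : ∀ x → 1 ∸ toℕ x ≡ toℕ (not x)
  toℕ-not false = refl
  toℕ-not true = refl

_∨ᶜ_ : ComputableBool p → ComputableBool q → ComputableBool (λ xs → p xs ∨ q xs)
_∨ᶜ_ {p = p} {q = q} cp cq =
  computable-cong (λ xs → cong toℕ (de-morgan (p xs) (q xs))) (notᶜ (notᶜ cp ∧ᶜ notᶜ cq))
  where
  de-morgan : ∀ x y → not (not x ∧ not y) ≡ x ∨ y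
  de-morgan false y = not-involutive y
  de-morgan true y = refl

_≟ᶜ_ : Computable a → Computable b → ComputableBool (λ xs → does (a xs ≟ b xs))
_≟ᶜ_ {a = a} {b = b} ca cb = computable-cong (λ xs → toℕ-≡ᵇ (a xs) (b xs))
  (constᶜ 1 ∸ᶜ ((ca ∸ᶜ cb) +ᶜ (cb ∸ᶜ ca)))
  where
  toℕ-≡ᵇ : ∀ x y → 1 ∸ ((x ∸ y) + (y ∸ x)) ≡ toℕ (x ≡ᵇ y)
  toℕ-≡ᵇ zero zero = refl
  toℕ-≡ᵇ zero (suc y) = 0∸n≡0 y
  toℕ-≡ᵇ (suc x) zero = 0∸n≡0 (x + 0)
  toℕ-≡ᵇ (suc x) (suc y) = toℕ-≡ᵇ x y

anyUpTo?-suc : {A : ℕ → Set} (A? : Decidable A) (v : ℕ) →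
  does (anyUpTo? A? (suc v)) ≡ does (A? v) ∨ does (anyUpTo? A? v)
anyUpTo?-suc A? v with A? v | anyUpTo? A? v
... | yes _ | _ = refl
... | no _ | yes _ = refl
... | no _ | no _ = refl

anyUpToᶜ : {A : ℕ → Vec ℕ n → Set} (A? : ∀ z xs → Dec (A z xs)) →
  ComputableBool (λ xs → does (A? (head xs) (tail xs))) → Computable b →
  ComputableBool (λ xs → does (anyUpTo? (λ z → A? z xs) (b xs)))
anyUpToᶜ {b = b} A? cA cb = computable-cong (λ xs → rec-any (b xs) xs)
  (primrecᶜ (constᶜ 0) (skip-accumulator ∨ᶜ weakenᶜ headᶜ ≟ᶜ constᶜ 1) cb)
  where
  skip-accumulator : ComputableBool (λ zs → does (A? (head zs) (tail (tail zs))))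
  skip-accumulator =
    computable-cong (λ { (z ∷ _ ∷ xs) → cong (λ ys → toℕ (does (A? z ys))) (tabulate∘lookup xs) })
      (cA ∘ᶜ selectᶜ (λ { zero → zero ; (suc i) → suc (suc i) }))
  toℕ-≡ᵇ-1 : ∀ x → (toℕ x ≡ᵇ 1) ≡ x
  toℕ-≡ᵇ-1 false = refl
  toℕ-≡ᵇ-1 true = refl
  rec-any : ∀ y xs → primrec (λ _ → 0) (λ z acc xs → toℕ (does (A? z xs) ∨ (acc ≡ᵇ 1))) y xs
                     ≡ toℕ (does (anyUpTo? (λ z → A? z xs) y))
  rec-any zero xs = refl
  rec-any (suc y) xs = begin
    toℕ (does (A? y xs) ∨ (primrec _ _ y xs ≡ᵇ 1))
      ≡⟨ cong (λ r → toℕ (does (A? y xs) ∨ (r ≡ᵇ 1))) (rec-any y xs) ⟩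
    toℕ (does (A? y xs) ∨ (toℕ (does (anyUpTo? _ y)) ≡ᵇ 1))
      ≡⟨ cong (λ r → toℕ (does (A? y xs) ∨ r)) (toℕ-≡ᵇ-1 _) ⟩
    toℕ (does (A? y xs) ∨ does (anyUpTo? _ y))
      ≡⟨ cong toℕ (sym (anyUpTo?-suc (λ z → A? z xs) y)) ⟩
    toℕ (does (anyUpTo? (λ z → A? z xs) (suc y))) ∎
    where open ≡-Reasoning

module _ {A : Set} {e : PR n} {xs : Vec ℕ n} where
  ⇓-decides : (a? : Dec A) → e [ xs ]⇓ toℕ (does a?) → (A → e [ xs ]⇓ 1) × (¬ A → e [ xs ]⇓ 0)
  ⇓-decides (yes a) e⇓ = (λ _ → e⇓) , (λ ¬a → contradiction a ¬a)
  ⇓-decides (no ¬a) e⇓ = (λ a → contradiction a ¬a) , (λ _ → e⇓)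

  decides-⇓ : (a? : Dec A) → (A → e [ xs ]⇓ 1) × (¬ A → e [ xs ]⇓ 0) → e [ xs ]⇓ toℕ (does a?)
  decides-⇓ (yes a) (e⇓1 , _) = e⇓1 a
  decides-⇓ (no ¬a) (_ , e⇓0) = e⇓0 ¬a

computable⇒ComputableSet : {A : ℕ → Set} (A? : Decidable A) →
  ComputableBool (λ xs → does (A? (head xs))) → ComputableSet A
computable⇒ComputableSet A? (e , e⇓) = e , λ x → ⇓-decides (A? x) (e⇓ (x ∷ []))

computable⇒ComputableRel : {A : ℕ → ℕ → Set} (A? : ∀ x y → Dec (A x y)) →
  ComputableBool (λ xs → does (A? (head xs) (head (tail xs)))) → ComputableRel A
computable⇒ComputableRel A? (e , e⇓) = e , λ x y → ⇓-decides (A? x y) (e⇓ (x ∷ y ∷ []))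

ComputableRel⇒computable : {A : ℕ → ℕ → Set} (A? : ∀ x y → Dec (A x y)) →
  ComputableRel A → ComputableBool (λ xs → does (A? (head xs) (head (tail xs))))
ComputableRel⇒computable A? (e , e-decides) =
  e , λ { (x ∷ y ∷ []) → decides-⇓ (A? x y) (e-decides x y) }

∈?ᶜ : (ys : List ℕ) → ComputableBool {1} (λ xs → does (head xs ∈? ys))
∈?ᶜ [] = constᶜ 0
∈?ᶜ (y ∷ ys) = headᶜ ≟ᶜ constᶜ y ∨ᶜ ∈?ᶜ ys

finite⇒ComputableSet : {A : ℕ → Set} → Decidable A → Finite A → ComputableSet A
finite⇒ComputableSet {A} A? (N , none-beyond-N) =
  computable⇒ComputableSet A-via-list (∈?ᶜ (filter A? (upTo N)))
  where
  A-via-list : Decidable A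
  A-via-list x = map′ (proj₂ ∘ ∈-filter⁻ A? {xs = upTo N})
    (λ ax → ∈-filter⁺ A? (∈-upTo⁺ (≰⇒> (λ N≤x → none-beyond-N x N≤x ax))) ax)
    (x ∈? filter A? (upTo N))

-- Least witnesses, bounded search and counting

holds : {A : Set} (a? : Dec A) → does a? ≡ true → A
holds (yes a) _ = a

∃-bounded? : {A : ℕ → Set} → Decidable A → ∀ n → (∀ {k} → A k → k < n) → Dec (∃ A)
∃-bounded? A? n bound =
  map′ (λ (k , _ , a) → k , a) (λ (k , a) → k , bound a , a) (anyUpTo? A? n)

Least : (ℕ → Set) → ℕ → Set
Least A m = A m × ¬ (∃ λ z → z < m × A z)

module _ {A : ℕ → Set} (A? : Decidable A) where
  least? : Decidable (Least A)
  least? m = A? m ×-dec ¬? (anyUpTo? A? m)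

  least-below : ∀ n → (∃ λ z → z < n × A z) → ∃ (Least A)
  least-below (suc n) (z , z<1+n , az) with anyUpTo? A? n
  ... | yes below-n = least-below n below-n
  ... | no nothing-below-n with m≤n⇒m<n∨m≡n (s≤s⁻¹ z<1+n)
  ...   | inj₁ z<n = contradiction (z , z<n , az) nothing-below-n
  ...   | inj₂ refl = z , az , nothing-below-n

  least-exists : ∀ {y} → A y → ∃ (Least A)
  least-exists {y} ay = least-below (suc y) (y , ≤-refl , ay)

least-unique : {A : ℕ → Set} {m m′ : ℕ} → Least A m → Least A m′ → m ≡ m′
least-unique {m = m} {m′} (am , below-m) (am′ , below-m′) with <-cmp m m′
... | tri< m<m′ _ _ = contradiction (m , m<m′ , am) below-m′
... | tri≈ _ m≡m′ _ = m≡m′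
... | tri> _ _ m′<m = contradiction (m′ , m′<m , am′) below-m

Unbounded : (ℕ → Set) → Set
Unbounded A = ∀ N → ∃ λ x → N ≤ x × A x

Inf⇒unbounded : ExcludedMiddle 0ℓ → {A : ℕ → Set} → Inf A → Unbounded A
Inf⇒unbounded lem {A} inf N with lem {∃ λ x → N ≤ x × A x}
... | yes beyond-N = beyond-N
... | no none = contradiction (N , λ x N≤x ax → none (x , N≤x , ax)) inf

module Counting {A : ℕ → Set} (A? : Decidable A) where
  count : ℕ → ℕ
  count zero = 0
  count (suc n) = toℕ (does (A? n)) + count n

  count-suc : ∀ {x} → A x → count (suc x) ≡ suc (count x)
  count-suc {x} ax = cong (λ b → toℕ b + count x) (dec-true (A? x) ax)

  count-mono : ∀ {x y} → x ≤ y → count x ≤ count y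
  count-mono = mono′ ∘ ≤⇒≤′
    where
    mono′ : ∀ {x y} → x ≤′ y → count x ≤ count y
    mono′ ≤′-refl = ≤-refl
    mono′ (≤′-step x≤′y) = ≤-trans (mono′ x≤′y) (m≤n+m _ _)

  count-strict : ∀ {x y} → A x → x < y → count x < count y
  count-strict ax x<y = ≤-trans (≤-reflexive (sym (count-suc ax))) (count-mono x<y)

  count-injective : ∀ {x y} → A x → A y → count x ≡ count y → x ≡ y
  count-injective {x} {y} ax ay eq with <-cmp x y
  ... | tri< x<y _ _ = contradiction (count-strict ax x<y) (<-irrefl eq)
  ... | tri≈ _ x≡y _ = x≡y
  ... | tri> _ _ y<x = contradiction (count-strict ay y<x) (<-irrefl (sym eq))

  count-reaches : ∀ N k → k < count N → ∃ λ x → A x × count x ≡ k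
  count-reaches (suc N) k k< with A? N
  ... | no _ = count-reaches N k k<
  ... | yes aN with m≤n⇒m<n∨m≡n (s≤s⁻¹ k<)
  ...   | inj₁ k<count = count-reaches N k k<count
  ...   | inj₂ refl = N , aN , refl

  count-unbounded : Unbounded A → ∀ k → ∃ λ N → k ≤ count N
  count-unbounded unbounded zero = 0 , z≤n
  count-unbounded unbounded (suc k) =
    let N , k≤count = count-unbounded unbounded k
        x , N≤x , ax = unbounded N
    in suc x , ≤-trans (s≤s (≤-trans k≤count (count-mono N≤x))) (≤-reflexive (sym (count-suc ax)))

  count-surjective : Unbounded A → ∀ k → ∃ λ x → A x × count x ≡ k
  count-surjective unbounded k =
    let N , k<count = count-unbounded unbounded (suc k) in count-reaches N k k<count

-- Pairing

pair : ℕ → ℕ → ℕ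
pair x y = (x + y) * (x + y) + x

≤-pairˡ : ∀ x y → x ≤ pair x y
≤-pairˡ x y = m≤n+m x _

≤-pairʳ : ∀ x y → y ≤ pair x y
≤-pairʳ x y = ≤-trans (m≤n+m y x) (≤-trans (n≤n*n (x + y)) (m≤m+n _ x))
  where
  n≤n*n : ∀ n → n ≤ n * n
  n≤n*n zero = z≤n
  n≤n*n (suc n) = s≤s (m≤m+n n _)

pair-<-sum : ∀ x y x′ y′ → x + y < x′ + y′ → pair x y < pair x′ y′
pair-<-sum x y x′ y′ s<s′ = begin-strict
  s * s + x        ≤⟨ +-monoʳ-≤ (s * s) (m≤m+n x y) ⟩
  s * s + s        ≡⟨ +-comm (s * s) s ⟩
  s + s * s        ≤⟨ m≤n+m (s + s * s) s ⟩
  s + (s + s * s)  ≡⟨ cong (s +_) (sym (*-suc s s)) ⟩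
  s + s * suc s    <⟨ ≤-refl ⟩
  suc s * suc s    ≤⟨ *-mono-≤ s<s′ s<s′ ⟩
  s′ * s′          ≤⟨ m≤m+n _ x′ ⟩
  s′ * s′ + x′     ∎
  where
  open ≤-Reasoning
  s = x + y
  s′ = x′ + y′

pair-injective : ∀ x y x′ y′ → pair x y ≡ pair x′ y′ → x ≡ x′ × y ≡ y′
pair-injective x y x′ y′ eq with <-cmp (x + y) (x′ + y′)
... | tri< s<s′ _ _ = contradiction (pair-<-sum x y x′ y′ s<s′) (<-irrefl eq)
... | tri> _ _ s′<s = contradiction (pair-<-sum x′ y′ x y s′<s) (<-irrefl (sym eq))
... | tri≈ _ s≡s′ _ = x≡x′ , +-cancelˡ-≡ x y y′ (trans s≡s′ (cong (_+ y′) (sym x≡x′)))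
  where
  x≡x′ : x ≡ x′
  x≡x′ = +-cancelˡ-≡ ((x + y) * (x + y)) x x′ (trans eq (cong (λ s → s * s + x′) (sym s≡s′)))

pairᶜ : Computable a → Computable b → Computable (λ xs → pair (a xs) (b xs))
pairᶜ ca cb = (ca +ᶜ cb) *ᶜ (ca +ᶜ cb) +ᶜ ca

≡true-reflects : ∀ b → Reflects (b ≡ true) b
≡true-reflects false = ofⁿ λ ()
≡true-reflects true = ofʸ refl

vertex? : (G : Graph) → Decidable (_∈V G)
vertex? G x = V G x because ≡true-reflects (V G x)

adj? : (G : Graph) → ∀ x y → Dec (Adj G x y)
adj? G x y = E G x y because ≡true-reflects (E G x y)

≅-refl : ∀ {G} → G ≅ G
≅-refl = record
  { to = λ x → x ; from = λ x → x ; to-V = λ _ vx → vx ; from-V = λ _ vx → vx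
  ; from-to = λ _ _ → refl ; to-from = λ _ _ → refl ; adj = λ _ _ _ _ → refl }

module _ (lem : ExcludedMiddle 0ℓ) {G H : Graph} (f : ℕ → ℕ) where
  bijection⇒≅ : (∀ {x} → x ∈V G → f x ∈V H) →
                (∀ {x y} → x ∈V G → y ∈V G → f x ≡ f y → x ≡ y) →
                (∀ {n} → n ∈V H → ∃ λ x → x ∈V G × f x ≡ n) →
                (∀ {x y} → x ∈V G → y ∈V G → E G x y ≡ E H (f x) (f y)) →
                G ≅ H
  bijection⇒≅ f-V f-injective f-surjective f-adj = record
    { to = f
    ; from = λ n → preimage n lem
    ; to-V = λ _ → f-V
    ; from-V = λ n vn → proj₁ (preimage-spec vn lem)
    ; from-to = λ x vx → let vx′ , fx′≡fx = preimage-spec (f-V vx) lem in f-injective vx′ vx fx′≡fx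
    ; to-from = λ n vn → proj₂ (preimage-spec vn lem)
    ; adj = λ _ _ → f-adj
    }
    where
    Preimage : ℕ → Set
    Preimage n = ∃ λ x → x ∈V G × f x ≡ n
    preimage : ∀ n → Dec (Preimage n) → ℕ
    preimage n (yes (x , _)) = x
    preimage n (no _) = 0
    preimage-spec : ∀ {n} → n ∈V H → (d : Dec (Preimage n)) → preimage n d ∈V G × f (preimage n d) ≡ n
    preimage-spec vn (yes (x , vx , fx≡n)) = vx , fx≡n
    preimage-spec vn (no none) = contradiction (f-surjective vn) none

-- The padded copy H of G

module Padding (G : Graph) where
  LeastNeighbour : ℕ → ℕ → Set
  LeastNeighbour x = Least (Adj G x)

  vertexCode : ℕ → ℕ → ℕ
  vertexCode x y = pair (pair x y) 0

  isolatedCode : ℕ → ℕ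
  isolatedCode k = pair k 1

  vertexCode-injective : ∀ {x y x′ y′} → vertexCode x y ≡ vertexCode x′ y′ → x ≡ x′
  vertexCode-injective {x} {y} {x′} {y′} =
    proj₁ ∘ pair-injective x y x′ y′ ∘ proj₁ ∘ pair-injective (pair x y) 0 (pair x′ y′) 0

  isolatedCode-injective : ∀ {k k′} → isolatedCode k ≡ isolatedCode k′ → k ≡ k′
  isolatedCode-injective {k} {k′} = proj₁ ∘ pair-injective k 1 k′ 1

  vertexCode≢isolatedCode : ∀ {x y k} → vertexCode x y ≢ isolatedCode k
  vertexCode≢isolatedCode {x} {y} {k} eq with proj₂ (pair-injective (pair x y) 0 k 1 eq)
  ... | ()

  RepresentsVia : ℕ → ℕ → ℕ → Set
  RepresentsVia n x y = n ≡ vertexCode x y × LeastNeighbour x y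

  Represents : ℕ → ℕ → Set
  Represents n x = ∃ (RepresentsVia n x)

  IsolatedCode : ℕ → Set
  IsolatedCode n = ∃ λ k → n ≡ isolatedCode k

  VertexH : ℕ → Set
  VertexH n = ∃ (Represents n) ⊎ IsolatedCode n

  AdjacentTo : ℕ → ℕ → Set
  AdjacentTo m x = ∃ λ x′ → Represents m x′ × Adj G x x′

  EdgeH : ℕ → ℕ → Set
  EdgeH n m = ∃ λ x → Represents n x × AdjacentTo m x

  represents-unique : ∀ {n x x′} → Represents n x → Represents n x′ → x ≡ x′
  represents-unique (_ , n≡ , _) (_ , n≡′ , _) = vertexCode-injective (trans (sym n≡) n≡′)

  represents⇒¬isolatedCode : ∀ {n x} → Represents n x → ¬ IsolatedCode n
  represents⇒¬isolatedCode {x = x} (y , n≡ , _) (k , n≡′) =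
    vertexCode≢isolatedCode {x} {y} {k} (trans (sym n≡) n≡′)

  represents-< : ∀ {n x} → Represents n x → x < suc n
  represents-< {x = x} (y , n≡ , _) =
    s≤s (subst (x ≤_) (sym n≡) (≤-trans (≤-pairˡ x y) (≤-pairˡ _ 0)))

  representsVia? : ∀ n x y → Dec (RepresentsVia n x y)
  representsVia? n x y = (n ≟ vertexCode x y) ×-dec least? (adj? G x) y

  represents? : ∀ n x → Dec (Represents n x)
  represents? n x = ∃-bounded? (representsVia? n x) (suc n)
    λ {y} (n≡ , _) → s≤s (subst (y ≤_) (sym n≡) (≤-trans (≤-pairʳ x y) (≤-pairˡ _ 0)))

  isolatedCode? : Decidable IsolatedCode
  isolatedCode? n = ∃-bounded? (λ k → n ≟ isolatedCode k) (suc n)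
    λ {k} n≡ → s≤s (subst (k ≤_) (sym n≡) (≤-pairˡ k 1))

  vertexH? : Decidable VertexH
  vertexH? n = ∃-bounded? (represents? n) (suc n) represents-< ⊎-dec isolatedCode? n

  adjacentTo? : ∀ m x → Dec (AdjacentTo m x)
  adjacentTo? m x =
    ∃-bounded? (λ x′ → represents? m x′ ×-dec adj? G x x′) (suc m) (represents-< ∘ proj₁)

  edgeH? : ∀ n m → Dec (EdgeH n m)
  edgeH? n m = ∃-bounded? (λ x → represents? n x ×-dec adjacentTo? m x) (suc n) (represents-< ∘ proj₁)

  EdgeH-irreflexive : ∀ n → ¬ EdgeH n n
  EdgeH-irreflexive n (x , rep , x′ , rep′ , x~x′) with refl ← represents-unique rep rep′ =
    contradiction (trans (sym x~x′) (irrefl G x)) λ ()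

  EdgeH-symmetric : ∀ {n m} → EdgeH n m → EdgeH m n
  EdgeH-symmetric (x , rep , x′ , rep′ , x~x′) = x′ , rep′ , x , rep , trans (Graph.sym G x′ x) x~x′

  H : Graph
  H = record
    { V = λ n → does (vertexH? n)
    ; E = λ n m → does (edgeH? n m)
    ; E-V = λ n m n~m → let x , rep , _ = holds (edgeH? n m) n~m
                        in dec-true (vertexH? n) (inj₁ (x , rep))
    ; irrefl = λ n → dec-false (edgeH? n n) (EdgeH-irreflexive n)
    ; sym = λ n m → does-⇔ (mk⇔ EdgeH-symmetric EdgeH-symmetric) (edgeH? n m) (edgeH? m n)
    }

  isolatedCode⇒Isolated : ∀ {n} → IsolatedCode n → Isolated H n
  isolatedCode⇒Isolated {n} code =
    dec-true (vertexH? n) (inj₂ code) ,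
    λ m n~m → let _ , rep , _ = holds (edgeH? n m) n~m in represents⇒¬isolatedCode rep code

  -- A represented vertex x has a neighbour y, which is non-isolated too, so the code of y is adjacent.
  Isolated⇒isolatedCode : ∀ {n} → Isolated H n → IsolatedCode n
  Isolated⇒isolatedCode {n} (vn , no-edge) with holds (vertexH? n) vn
  ... | inj₂ code = code
  ... | inj₁ (x , y , n≡ , least-y@(x~y , _)) =
    let l , least-l = least-exists (adj? G y) (trans (Graph.sym G y x) x~y)
        edge = x , (y , n≡ , least-y) , y , (l , refl , least-l) , x~y
    in contradiction (dec-true (edgeH? n (vertexCode y l)) edge) (no-edge _)

  isolatedH? : Decidable (Isolated H)
  isolatedH? n = map′ isolatedCode⇒Isolated Isolated⇒isolatedCode (isolatedCode? n)

  module _ (adj-computable : ComputableRel (Adj G)) where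
    adjᶜ : Computable a → Computable b → ComputableBool (λ xs → E G (a xs) (b xs))
    adjᶜ ca cb = ComputableRel⇒computable (adj? G) adj-computable ∘ᶜ ca ∷ᶜ cb ∷ᶜ []ᶜ

    leastNeighbourᶜ : Computable a → Computable b →
                      ComputableBool (λ xs → does (least? (adj? G (a xs)) (b xs)))
    leastNeighbourᶜ {a = a} ca cb =
      adjᶜ ca cb ∧ᶜ notᶜ (anyUpToᶜ (λ z xs → adj? G (a xs) z) (adjᶜ (weakenᶜ ca) headᶜ) cb)

    representsᶜ : Computable a → Computable b → ComputableBool (λ xs → does (represents? (a xs) (b xs)))
    representsᶜ {a = a} {b = b} ca cb = anyUpToᶜ (λ y xs → representsVia? (a xs) (b xs) y)
      (weakenᶜ ca ≟ᶜ pairᶜ (pairᶜ (weakenᶜ cb) headᶜ) (constᶜ 0) ∧ᶜ leastNeighbourᶜ (weakenᶜ cb) headᶜ)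
      (sucᶜ ca)

    isolatedCodeᶜ : Computable a → ComputableBool (λ xs → does (isolatedCode? (a xs)))
    isolatedCodeᶜ {a = a} ca =
      anyUpToᶜ (λ k xs → a xs ≟ isolatedCode k) (weakenᶜ ca ≟ᶜ pairᶜ headᶜ (constᶜ 1)) (sucᶜ ca)

    adjacentToᶜ : Computable a → Computable b → ComputableBool (λ xs → does (adjacentTo? (a xs) (b xs)))
    adjacentToᶜ {a = a} {b = b} ca cb =
      anyUpToᶜ (λ x′ xs → represents? (a xs) x′ ×-dec adj? G (b xs) x′)
        (representsᶜ (weakenᶜ ca) headᶜ ∧ᶜ adjᶜ (weakenᶜ cb) headᶜ) (sucᶜ ca)

    vertexHᶜ : ComputableBool {1} (λ xs → does (vertexH? (head xs)))
    vertexHᶜ =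
      anyUpToᶜ (λ x xs → represents? (head xs) x) (representsᶜ (weakenᶜ headᶜ) headᶜ) (sucᶜ headᶜ)
      ∨ᶜ isolatedCodeᶜ headᶜ

    edgeHᶜ : ComputableBool {2} (λ xs → does (edgeH? (head xs) (head (tail xs))))
    edgeHᶜ = anyUpToᶜ (λ x xs → represents? (head xs) x ×-dec adjacentTo? (head (tail xs)) x)
      (representsᶜ (weakenᶜ headᶜ) headᶜ ∧ᶜ adjacentToᶜ (weakenᶜ (weakenᶜ headᶜ)) headᶜ) (sucᶜ headᶜ)

    H-computable : ComputableGraph H
    H-computable = computable⇒ComputableSet (vertex? H) vertexHᶜ ,
                   computable⇒ComputableRel (adj? H) edgeHᶜ

    isolatedH-computable : ComputableSet (Isolated H)
    isolatedH-computable = computable⇒ComputableSet isolatedH? (isolatedCodeᶜ headᶜ)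

module Padding-≅ (lem : ExcludedMiddle 0ℓ) (G : Graph) (unbounded : Unbounded (Isolated G)) where
  open Padding G
  open Counting (λ x → lem {Isolated G x}) renaming (count to rank)

  toH : ℕ → ℕ
  toH x with lem {∃ (Adj G x)}
  ... | yes (y , x~y) = vertexCode x (proj₁ (least-exists (adj? G x) x~y))
  ... | no _ = isolatedCode (rank x)

  toH-least : ∀ {x y} → LeastNeighbour x y → toH x ≡ vertexCode x y
  toH-least {x} least-y with lem {∃ (Adj G x)}
  ... | yes (_ , x~z) = cong (vertexCode x) (least-unique (proj₂ (least-exists (adj? G x) x~z)) least-y)
  ... | no none = contradiction (_ , proj₁ least-y) none

  toH-isolated : ∀ {x} → Isolated G x → toH x ≡ isolatedCode (rank x)
  toH-isolated {x} (_ , no-adj) with lem {∃ (Adj G x)}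
  ... | yes (y , x~y) = contradiction x~y (no-adj y)
  ... | no _ = refl

  classify : ∀ {x} → x ∈V G → ∃ (LeastNeighbour x) ⊎ Isolated G x
  classify {x} vx with lem {∃ (Adj G x)}
  ... | yes (_ , x~y) = inj₁ (least-exists (adj? G x) x~y)
  ... | no none = inj₂ (vx , λ y x~y → none (y , x~y))

  toH-represents : ∀ {x y} → LeastNeighbour x y → Represents (toH x) x
  toH-represents {y = y} least-y = y , toH-least least-y , least-y

  toH-isolatedCode : ∀ {x} → Isolated G x → IsolatedCode (toH x)
  toH-isolatedCode {x} iso = rank x , toH-isolated iso

  toH-represents-only : ∀ {x x′} → x ∈V G → Represents (toH x) x′ → x′ ≡ x
  toH-represents-only vx rep with classify vx
  ... | inj₁ (_ , least-y) = represents-unique rep (toH-represents least-y)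
  ... | inj₂ iso = contradiction (toH-isolatedCode iso) (represents⇒¬isolatedCode rep)

  toH-V : ∀ {x} → x ∈V G → toH x ∈V H
  toH-V {x} vx = dec-true (vertexH? (toH x))
    ([ (λ (_ , least-y) → inj₁ (x , toH-represents least-y)) , inj₂ ∘ toH-isolatedCode ] (classify vx))

  toH-injective : ∀ {x y} → x ∈V G → y ∈V G → toH x ≡ toH y → x ≡ y
  toH-injective vx vy eq with classify vx | classify vy
  ... | inj₁ (_ , least-x) | _ =
    toH-represents-only vy (subst (λ n → Represents n _) eq (toH-represents least-x))
  ... | inj₂ iso | inj₁ (_ , least-y) =
    contradiction (subst IsolatedCode eq (toH-isolatedCode iso))
                  (represents⇒¬isolatedCode (toH-represents least-y))
  ... | inj₂ iso | inj₂ iso′ =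
    count-injective iso iso′
      (isolatedCode-injective (trans (sym (toH-isolated iso)) (trans eq (toH-isolated iso′))))

  toH-surjective : ∀ {n} → n ∈V H → ∃ λ x → x ∈V G × toH x ≡ n
  toH-surjective {n} vn with holds (vertexH? n) vn
  ... | inj₁ (x , y , n≡ , least-y@(x~y , _)) = x , E-V G x y x~y , trans (toH-least least-y) (sym n≡)
  ... | inj₂ (k , n≡) =
    let x , iso , rank≡k = count-surjective unbounded k
    in x , proj₁ iso , trans (toH-isolated iso) (trans (cong isolatedCode rank≡k) (sym n≡))

  toH-adj : ∀ {x y} → x ∈V G → y ∈V G → E G x y ≡ E H (toH x) (toH y)
  toH-adj {x} {y} vx vy = does-⇔ (mk⇔ edge⇒edgeH edgeH⇒edge) (adj? G x y) (edgeH? (toH x) (toH y))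
    where
    edge⇒edgeH : Adj G x y → EdgeH (toH x) (toH y)
    edge⇒edgeH x~y =
      x , toH-represents (proj₂ (least-exists (adj? G x) x~y)) ,
      y , toH-represents (proj₂ (least-exists (adj? G y) (trans (Graph.sym G y x) x~y))) , x~y
    edgeH⇒edge : EdgeH (toH x) (toH y) → Adj G x y
    edgeH⇒edge (x′ , rep-x′ , y′ , rep-y′ , x′~y′)
      with refl ← toH-represents-only vx rep-x′ | refl ← toH-represents-only vy rep-y′ = x′~y′

  G≅H : G ≅ H
  G≅H = bijection⇒≅ lem toH toH-V toH-injective toH-surjective toH-adj

theorem3p3 : ExcludedMiddle 0ℓ → (G : Graph) → ComputableGraph G →
    Σ Graph (λ H → ComputableGraph H × (G ≅ H) × ComputableSet (Isolated H))
theorem3p3 lem G cg@(_ , adj-computable) with lem {Finite (Isolated G)}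
... | yes finite = G , cg , ≅-refl , finite⇒ComputableSet (λ _ → lem) finite
... | no infinite = H , H-computable adj-computable , G≅H , isolatedH-computable adj-computable
  where
  open Padding G
  open Padding-≅ lem G (Inf⇒unbounded lem infinite)
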